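{- Let $G$ be a graph isomorphic to one of $C_5$, the bull, the gem, the co-gem. Let $(A,B)$ be a partition of $V(G)$ into two sets (with $A$ possibly empty) with $|A|<|B|$, and let $H=G\oplus\mathcal{P}$ for some $\mathcal{P}\subseteq\{(A,A),(B,B)\}$. If $H$ has a connected component on exactly two vertices, then either (1) $G$ is the bull, $A$ consists of the two vertices of degree $1$, and $\mathcal{P}=\{(B,B)\}$; or (2) $G$ is the co-gem, $A$ consists of the two vertices of degree $2$, and $\mathcal{P}=\{(A,A)\}$.
   Context: All graphs are finite, simple. For $A,B\subseteq V(G)$, $G\oplus(A,B)$ is the graph on $V(G)$ in which the adjacency of distinct $u,v$ is toggled exactly when $(u,v)\in(A\times B)\cup(B\times A)$; $G\oplus\mathcal{P}$ applies all flips in $\mathcal{P}$. $C_5$ is the 5-cycle; with $abcd$ an induced path and a fifth vertex $v$: the bull has $v$ adjacent exactly to $b,c$; the gem has $v$ adjacent to all of $a,b,c,d$; the co-gem has $v$ isolated. -}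

module Defs where

open import Data.Nat using (ℕ; zero; suc; _+_)
open import Data.Bool using (Bool; true; false; _∧_; _∨_; _xor_; not; if_then_else_)
open import Data.Bool.Properties using (∨-comm)
open import Data.Fin using (Fin; zero; suc; toℕ; _≟_)
open import Data.Fin.Subset using (Subset)
open import Data.Vec using (lookup)
open import Data.List using (List; allFin; map)
open import Data.Nat.ListAction using (sum)
open import Data.Product using (Σ; _×_)
open import Data.Sum using (_⊎_)
open import Relation.Nullary using (¬_)
open import Relation.Binary.PropositionalEquality using (_≡_; refl)
open import Relation.Nullary using (yes; no)
open import Function.Bundles using (_↔_; Inverse)

record Graph (n : ℕ) : Set where
  field
    adj    : Fin n → Fin n → Bool
    sym    : ∀ u v → adj u v ≡ adj v u
    irrefl : ∀ v → adj v v ≡ false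
open Graph public

record _≅_ {n m : ℕ} (G : Graph n) (H : Graph m) : Set where
  field
    bij      : Fin n ↔ Fin m
    preserve : ∀ u v → adj G u v ≡ adj H (Inverse.to bij u) (Inverse.to bij v)

degree : ∀ {n} → Graph n → Fin n → ℕ
degree {n} G v = sum (map (λ w → if adj G v w then 1 else 0) (allFin n))

_==_ : ℕ → ℕ → Bool
zero == zero = true
zero == suc _ = false
suc _ == zero = false
suc a == suc b = a == b

symAdj : (ℕ → ℕ → Bool) → Fin 5 → Fin 5 → Bool
symAdj e u v = e (toℕ u) (toℕ v) ∨ e (toℕ v) (toℕ u)

symAdj-sym : ∀ e u v → symAdj e u v ≡ symAdj e v u
symAdj-sym e u v = ∨-comm (e (toℕ u) (toℕ v)) (e (toℕ v) (toℕ u))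

-- Edges on labels 0..4.  Path abcd = 0 1 2 3, fifth vertex v = 4.
-- C5: 0-1-2-3-4-0
c5E : ℕ → ℕ → Bool
c5E i j = ((i == 0) ∧ (j == 1)) ∨ ((i == 1) ∧ (j == 2)) ∨ ((i == 2) ∧ (j == 3))
        ∨ ((i == 3) ∧ (j == 4)) ∨ ((i == 4) ∧ (j == 0))

pathE : ℕ → ℕ → Bool
pathE i j = ((i == 0) ∧ (j == 1)) ∨ ((i == 1) ∧ (j == 2)) ∨ ((i == 2) ∧ (j == 3))

bullE : ℕ → ℕ → Bool
bullE i j = pathE i j ∨ ((i == 4) ∧ ((j == 1) ∨ (j == 2)))

gemE : ℕ → ℕ → Bool
gemE i j = pathE i j ∨ ((i == 4) ∧ ((j == 0) ∨ (j == 1) ∨ (j == 2) ∨ (j == 3)))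

cogemE : ℕ → ℕ → Bool
cogemE = pathE

private
  irr : (e : ℕ → ℕ → Bool) → e 0 0 ≡ false → e 1 1 ≡ false → e 2 2 ≡ false
      → e 3 3 ≡ false → e 4 4 ≡ false → ∀ v → symAdj e v v ≡ false
  irr e p0 p1 p2 p3 p4 zero rewrite p0 = refl
  irr e p0 p1 p2 p3 p4 (suc zero) rewrite p1 = refl
  irr e p0 p1 p2 p3 p4 (suc (suc zero)) rewrite p2 = refl
  irr e p0 p1 p2 p3 p4 (suc (suc (suc zero))) rewrite p3 = refl
  irr e p0 p1 p2 p3 p4 (suc (suc (suc (suc zero)))) rewrite p4 = refl

C5 : Graph 5
C5 = record { adj = symAdj c5E ; sym = symAdj-sym c5E
            ; irrefl = irr c5E refl refl refl refl refl }

bull : Graph 5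
bull = record { adj = symAdj bullE ; sym = symAdj-sym bullE
              ; irrefl = irr bullE refl refl refl refl refl }

gem : Graph 5
gem = record { adj = symAdj gemE ; sym = symAdj-sym gemE
             ; irrefl = irr gemE refl refl refl refl refl }

cogem : Graph 5
cogem = record { adj = symAdj cogemE ; sym = symAdj-sym cogemE
               ; irrefl = irr cogemE refl refl refl refl refl }

-- G ⊕ P for P ⊆ {(A,A),(B,B)} with B the complement of A:
-- flipAA = true iff (A,A) ∈ P, flipBB = true iff (B,B) ∈ P.
-- Adjacency of distinct u,v is toggled once for each flip whose product contains (u,v).
flipAB : ∀ {n} → Graph n → Subset n → (flipAA flipBB : Bool) → Fin n → Fin n → Bool
flipAB G A fA fB u v with u ≟ v
... | yes _ = false
... | no  _ = (adj G u v xor (fA ∧ (lookup A u ∧ lookup A v)))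
                 xor (fB ∧ (not (lookup A u) ∧ not (lookup A v)))

data Reach {n : ℕ} (E : Fin n → Fin n → Bool) (u : Fin n) : Fin n → Set where
  here : Reach E u u
  step : ∀ {v w} → Reach E u v → E v w ≡ true → Reach E u w

HasComponentOfSize2 : ∀ {n} → (Fin n → Fin n → Bool) → Set
HasComponentOfSize2 {n} E =
  Σ (Fin n) λ u → Σ (Fin n) λ v →
    (¬ (u ≡ v)) × Reach E u v × (∀ w → Reach E u w → (w ≡ u) ⊎ (w ≡ v))

-- A component of size two is an edge uv such that no other vertex is adjacent
-- to u or v; this local condition is decidable, and it is carried along a graph
-- isomorphism together with the partition, the flips and the degrees. So it
-- suffices to run the decision procedure on the four concrete graphs on five
-- vertices, over all 32 sets A and all 4 choices of flips.
module Submission where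

open import Defs
open import Data.Nat using (ℕ; zero; suc; _+_; _<_; _<?_)
import Data.Nat.Properties as ℕ
import Data.Nat.ListAction as List
open import Data.Bool using (Bool; true; false; not; if_then_else_)
import Data.Bool.Properties as Bool
open import Data.Fin using (Fin; zero; suc; _≟_)
open import Data.Fin.Properties using (all?; any?)
open import Data.Fin.Permutation using (_⟨$⟩ʳ_; _⟨$⟩ˡ_; inverseˡ; inverseʳ)
open import Data.Fin.Subset using (Subset; _∈_; ∁; ∣_∣)
open import Data.Fin.Subset.Properties using (_∈?_)
open import Data.Vec using ([]; _∷_; lookup; tabulate)
open import Data.Vec.Properties using (lookup∘tabulate; lookup-map; []=⇒lookup; lookup⇒[]=)
import Data.List as List using (map; tabulate)
open import Data.Product using (_×_; _,_; ∃₂; map₁)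
open import Data.Sum using (_⊎_; inj₁; inj₂)
import Data.Sum as Sum
open import Data.Empty using (⊥; ⊥-elim)
open import Function using (_∘_)
open import Function.Bundles using (_⇔_; mk⇔; Equivalence)
import Function.Properties.Equivalence as ⇔
open import Relation.Nullary using (Dec; yes; no; ¬?; map′; contradiction)
open import Relation.Nullary.Decidable using (_×-dec_; _⊎-dec_; _→-dec_; from-yes)
open import Relation.Binary.PropositionalEquality as ≡
  using (_≡_; _≢_; refl; trans; cong; subst; module ≡-Reasoning)
open import Algebra.Properties.CommutativeMonoid.Sum ℕ.+-0-commutativeMonoid
  using (sum; sum-permute; sum-cong-≗)

indicator : Bool → ℕ
indicator b = if b then 1 else 0

sum-map-tabulate : ∀ {n} {A : Set} (f : A → ℕ) (g : Fin n → A) →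
  List.sum (List.map f (List.tabulate g)) ≡ sum (f ∘ g)
sum-map-tabulate {zero}  f g = refl
sum-map-tabulate {suc n} f g = cong (f (g zero) +_) (sum-map-tabulate f (g ∘ suc))

degree≡sum : ∀ {n} (G : Graph n) v → degree G v ≡ sum (indicator ∘ adj G v)
degree≡sum G v = sum-map-tabulate (indicator ∘ adj G v) (λ w → w)

∣∣≡sum : ∀ {n} (A : Subset n) → ∣ A ∣ ≡ sum (indicator ∘ lookup A)
∣∣≡sum []          = refl
∣∣≡sum (true  ∷ A) = cong suc (∣∣≡sum A)
∣∣≡sum (false ∷ A) = ∣∣≡sum A

flipAB-irrefl : ∀ {n} (G : Graph n) A fA fB v → flipAB G A fA fB v v ≡ false
flipAB-irrefl G A fA fB v with v ≟ v
... | yes _   = refl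
... | no v≢v = contradiction refl v≢v

IsolatedEdge : ∀ {n} → (Fin n → Fin n → Bool) → Fin n → Fin n → Set
IsolatedEdge E u v =
  u ≢ v × E u v ≡ true × (∀ w → E u w ≡ true ⊎ E v w ≡ true → w ≡ u ⊎ w ≡ v)

HasIsolatedEdge : ∀ {n} → (Fin n → Fin n → Bool) → Set
HasIsolatedEdge E = ∃₂ (IsolatedEdge E)

component⇒isolatedEdge : ∀ {n} {E : Fin n → Fin n → Bool} → (∀ v → E v v ≡ false) →
  HasComponentOfSize2 E → HasIsolatedEdge E
component⇒isolatedEdge {E = E} irrefl (u , v , u≢v , u⇝v , closed) =
  u , v , u≢v , edge u⇝v refl , neighbours
  where
  -- The last step of a path from u to v starts in {u, v}, hence at u.
  edge : ∀ {y} → Reach E u y → y ≡ v → E u v ≡ true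
  edge here u≡v = contradiction u≡v u≢v
  edge (step {x} u⇝x x~v) refl with closed x u⇝x
  ... | inj₁ refl = x~v
  ... | inj₂ refl = contradiction (trans (≡.sym (irrefl v)) x~v) λ ()

  neighbours : ∀ w → E u w ≡ true ⊎ E v w ≡ true → w ≡ u ⊎ w ≡ v
  neighbours w (inj₁ u~w) = closed w (step here u~w)
  neighbours w (inj₂ v~w) = closed w (step u⇝v v~w)

IsDegreeClass : ∀ {n} → Graph n → ℕ → Subset n → Set
IsDegreeClass G k A = ∀ v → v ∈ A ⇔ degree G v ≡ k

Outcome : ∀ {n} → ℕ → Bool → Bool → Graph n → Subset n → Bool → Bool → Set
Outcome k a b G A fA fB = IsDegreeClass G k A × fA ≡ a × fB ≡ b

FlipClaim : ∀ {n} → Graph n → (Subset n → Bool → Bool → Set) → Set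
FlipClaim G P =
  ∀ A fA fB → ∣ A ∣ < ∣ ∁ A ∣ → HasIsolatedEdge (flipAB G A fA fB) → P A fA fB

module Transport {n m} {G : Graph n} {X : Graph m} (iso : G ≅ X) where
  open _≅_ iso

  to : Fin n → Fin m
  to = bij ⟨$⟩ʳ_

  from : Fin m → Fin n
  from = bij ⟨$⟩ˡ_

  to-injective : ∀ {u v} → to u ≡ to v → u ≡ v
  to-injective eq = trans (≡.sym (inverseˡ bij)) (trans (cong from eq) (inverseˡ bij))

  transport : Subset n → Subset m
  transport A = tabulate (lookup A ∘ from)

  lookup-transport : ∀ A u → lookup (transport A) (to u) ≡ lookup A u
  lookup-transport A u =
    trans (lookup∘tabulate (lookup A ∘ from) (to u)) (cong (lookup A) (inverseˡ bij))

  ∣∣-transport : ∀ (B : Subset m) A → (∀ u → lookup B (to u) ≡ lookup A u) → ∣ B ∣ ≡ ∣ A ∣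
  ∣∣-transport B A B∘to≗A = begin
    ∣ B ∣                           ≡⟨ ∣∣≡sum B ⟩
    sum (indicator ∘ lookup B)      ≡⟨ sum-permute (indicator ∘ lookup B) bij ⟩
    sum (indicator ∘ lookup B ∘ to) ≡⟨ sum-cong-≗ (cong indicator ∘ B∘to≗A) ⟩
    sum (indicator ∘ lookup A)      ≡⟨ ≡.sym (∣∣≡sum A) ⟩
    ∣ A ∣                           ∎
    where open ≡-Reasoning

  ∣∁∣-transport : ∀ A → ∣ ∁ (transport A) ∣ ≡ ∣ ∁ A ∣
  ∣∁∣-transport A = ∣∣-transport (∁ (transport A)) (∁ A) λ u → begin
    lookup (∁ (transport A)) (to u) ≡⟨ lookup-map (to u) not (transport A) ⟩
    not (lookup (transport A) (to u)) ≡⟨ cong not (lookup-transport A u) ⟩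
    not (lookup A u)                ≡⟨ ≡.sym (lookup-map u not A) ⟩
    lookup (∁ A) u                  ∎
    where open ≡-Reasoning

  degree-to : ∀ v → degree X (to v) ≡ degree G v
  degree-to v = begin
    degree X (to v)                      ≡⟨ degree≡sum X (to v) ⟩
    sum (indicator ∘ adj X (to v))       ≡⟨ sum-permute (indicator ∘ adj X (to v)) bij ⟩
    sum (indicator ∘ adj X (to v) ∘ to) ≡⟨ sum-cong-≗ (cong indicator ∘ ≡.sym ∘ preserve v) ⟩
    sum (indicator ∘ adj G v)            ≡⟨ ≡.sym (degree≡sum G v) ⟩
    degree G v                           ∎
    where open ≡-Reasoning

  ∈-transport : ∀ A v → to v ∈ transport A ⇔ v ∈ A
  ∈-transport A v = mk⇔
    (λ p → lookup⇒[]= v A (trans (≡.sym (lookup-transport A v)) ([]=⇒lookup p)))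
    (λ p → lookup⇒[]= (to v) (transport A) (trans (lookup-transport A v) ([]=⇒lookup p)))

  isDegreeClass-transport : ∀ {k A} → IsDegreeClass X k (transport A) → IsDegreeClass G k A
  isDegreeClass-transport {k} {A} class v = ⇔.trans (⇔.sym (∈-transport A v))
    (subst (λ d → to v ∈ transport A ⇔ d ≡ k) (degree-to v) (class (to v)))

  flipAB-to : ∀ A fA fB u v → flipAB X (transport A) fA fB (to u) (to v) ≡ flipAB G A fA fB u v
  flipAB-to A fA fB u v with u ≟ v | to u ≟ to v
  ... | yes _    | yes _   = refl
  ... | yes refl | no ne   = contradiction refl ne
  ... | no ne    | yes eq  = contradiction (to-injective eq) ne
  ... | no _     | no _
    rewrite preserve u v | lookup-transport A u | lookup-transport A v = refl

  isolatedEdge-to : ∀ {E : Fin n → Fin n → Bool} {E′ : Fin m → Fin m → Bool} →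
    (∀ u v → E′ (to u) (to v) ≡ E u v) →
    ∀ {u v} → IsolatedEdge E u v → IsolatedEdge E′ (to u) (to v)
  isolatedEdge-to {E} {E′} E′∘to≡E {u} {v} (u≢v , u~v , closed) =
    u≢v ∘ to-injective , trans (E′∘to≡E u v) u~v , neighbours
    where
    back : ∀ x w → E′ (to x) w ≡ true → E x (from w) ≡ true
    back x w x~w =
      trans (≡.sym (E′∘to≡E x (from w))) (trans (cong (E′ (to x)) (inverseʳ bij)) x~w)

    forth : ∀ {x} w → from w ≡ x → w ≡ to x
    forth w refl = ≡.sym (inverseʳ bij)

    neighbours : ∀ w → E′ (to u) w ≡ true ⊎ E′ (to v) w ≡ true → w ≡ to u ⊎ w ≡ to v
    neighbours w adjacent with closed (from w) (Sum.map (back u w) (back v w) adjacent)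
    ... | inj₁ w≡u = inj₁ (forth w w≡u)
    ... | inj₂ w≡v = inj₂ (forth w w≡v)

  flipClaim-transport : ∀ {P} → FlipClaim X P → ∀ A fA fB → ∣ A ∣ < ∣ ∁ A ∣ →
    HasComponentOfSize2 (flipAB G A fA fB) → P (transport A) fA fB
  flipClaim-transport claim A fA fB small component
    with component⇒isolatedEdge (flipAB-irrefl G A fA fB) component
  ... | u , v , edge = claim (transport A) fA fB small′
    (to u , to v , isolatedEdge-to {E′ = flipAB X (transport A) fA fB} (flipAB-to A fA fB) edge)
    where
    small′ : ∣ transport A ∣ < ∣ ∁ (transport A) ∣
    small′ rewrite ∣∣-transport (transport A) A (lookup-transport A) | ∣∁∣-transport A = small

isolatedEdge? : ∀ {n} (E : Fin n → Fin n → Bool) u v → Dec (IsolatedEdge E u v)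
isolatedEdge? E u v =
  ¬? (u ≟ v) ×-dec E u v Bool.≟ true ×-dec
  all? (λ w → (E u w Bool.≟ true ⊎-dec E v w Bool.≟ true) →-dec (w ≟ u ⊎-dec w ≟ v))

hasIsolatedEdge? : ∀ {n} (E : Fin n → Fin n → Bool) → Dec (HasIsolatedEdge E)
hasIsolatedEdge? E = any? λ u → any? (isolatedEdge? E u)

_⇔-dec_ : ∀ {a b} {A : Set a} {B : Set b} → Dec A → Dec B → Dec (A ⇔ B)
a? ⇔-dec b? = map′ (λ (f , g) → mk⇔ f g) (λ e → Equivalence.to e , Equivalence.from e)
  ((a? →-dec b?) ×-dec (b? →-dec a?))

allBool? : ∀ {p} {P : Bool → Set p} → (∀ b → Dec (P b)) → Dec (∀ b → P b)
allBool? P? = map′ (λ { (t , f) true → t ; (t , f) false → f }) (λ h → h true , h false)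
  (P? true ×-dec P? false)

allSubsets? : ∀ {n p} {P : Subset n → Set p} → (∀ A → Dec (P A)) → Dec (∀ A → P A)
allSubsets? {zero}  P? = map′ (λ { p [] → p }) (λ h → h []) (P? [])
allSubsets? {suc n} P? =
  map′ (λ { (t , f) (true ∷ A) → t A ; (t , f) (false ∷ A) → f A })
       (λ h → (λ A → h (true ∷ A)) , (λ A → h (false ∷ A)))
       (allSubsets? (P? ∘ (true ∷_)) ×-dec allSubsets? (P? ∘ (false ∷_)))

outcome? : ∀ {n} k a b (G : Graph n) A fA fB → Dec (Outcome k a b G A fA fB)
outcome? k a b G A fA fB =
  all? (λ v → (v ∈? A) ⇔-dec (degree G v ℕ.≟ k)) ×-dec fA Bool.≟ a ×-dec fB Bool.≟ b

flipClaim? : ∀ {n} (G : Graph n) {P : Subset n → Bool → Bool → Set} →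
  (∀ A fA fB → Dec (P A fA fB)) → Dec (FlipClaim G P)
flipClaim? G P? = allSubsets? λ A → allBool? λ fA → allBool? λ fB →
  ∣ A ∣ <? ∣ ∁ A ∣ →-dec hasIsolatedEdge? (flipAB G A fA fB) →-dec P? A fA fB

Impossible : ∀ {n} → Subset n → Bool → Bool → Set
Impossible _ _ _ = ⊥

impossible? : ∀ {n} (A : Subset n) fA fB → Dec (Impossible A fA fB)
impossible? _ _ _ = no λ ()

C5-flipClaim : FlipClaim C5 Impossible
C5-flipClaim = from-yes (flipClaim? C5 impossible?)

gem-flipClaim : FlipClaim gem Impossible
gem-flipClaim = from-yes (flipClaim? gem impossible?)

bull-flipClaim : FlipClaim bull (Outcome 1 false true bull)
bull-flipClaim = from-yes (flipClaim? bull (outcome? 1 false true bull))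

cogem-flipClaim : FlipClaim cogem (Outcome 2 true false cogem)
cogem-flipClaim = from-yes (flipClaim? cogem (outcome? 2 true false cogem))

lemma3p4 : ∀ {n} (G : Graph n) →
    (G ≅ C5) ⊎ (G ≅ bull) ⊎ (G ≅ gem) ⊎ (G ≅ cogem) →
    (A : Subset n) → ∣ A ∣ < ∣ ∁ A ∣ →
    (flipAA flipBB : Bool) →
    HasComponentOfSize2 (flipAB G A flipAA flipBB) →
    ((G ≅ bull) × (∀ v → (v ∈ A) ⇔ (degree G v ≡ 1)) × (flipAA ≡ false) × (flipBB ≡ true))
    ⊎ ((G ≅ cogem) × (∀ v → (v ∈ A) ⇔ (degree G v ≡ 2)) × (flipAA ≡ true) × (flipBB ≡ false))
lemma3p4 G (inj₁ iso) A small fA fB component =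
  ⊥-elim (Transport.flipClaim-transport iso C5-flipClaim A fA fB small component)
lemma3p4 G (inj₂ (inj₂ (inj₁ iso))) A small fA fB component =
  ⊥-elim (Transport.flipClaim-transport iso gem-flipClaim A fA fB small component)
lemma3p4 G (inj₂ (inj₁ iso)) A small fA fB component =
  inj₁ (iso , map₁ (Transport.isDegreeClass-transport iso)
                   (Transport.flipClaim-transport iso bull-flipClaim A fA fB small component))
lemma3p4 G (inj₂ (inj₂ (inj₂ iso))) A small fA fB component =
  inj₂ (iso , map₁ (Transport.isDegreeClass-transport iso)
                   (Transport.flipClaim-transport iso cogem-flipClaim A fA fB small component))
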